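{- Let $n\ge0$ and $\pi\in S_n$. Then the sum of the $W_1$-weights of all colored permutations constructed from $\pi$ by the construction described in the context (over all choices of $d_1,\dots,d_{n+1},r_1,\dots,r_n\ge0$) equals \[ x^n\cdot\alpha^{f(\pi)}\cdot\frac{1}{(1-\alpha tx)^{n+1}}\cdot\frac{1}{(1-ux)^{n}}, \] as a formal power series in $x$ with coefficients in $\mathbb{Z}[\alpha,t,u]$.
   Context: $S_n$ is the symmetric group on $[n]$ ($S_0$ contains only the empty permutation), and $f(\sigma)$ denotes the number of cycles of a permutation $\sigma$. A colored permutation is a permutation $\tau\in S_N$ together with a choice of a subset of its fixed points (colored red) and a subset of its generalized successions, i.e. indices $i$ with $\tau(i)\equiv i+1\pmod N$ (colored yellow). Its $W_1$-weight is $x^N\alpha^{f(\tau)}t^{a}u^{b}$, where $a$ is the number of red fixed points and $b$ the number of yellow indices $i$ with $\tau(i)=i+1$. Construction: given $\pi\in S_n$ and nonnegative integers $d_1,\dots,d_{n+1},r_1,\dots,r_n$, let $N=n+\sum d_p+\sum r_q$ and arrange $N$ positions in a row, labelled $1,\dots,N$ from left to right, consisting of: a block of $d_1$ new points, then a run of $r_1+1$ consecutive points $1^{(0)}<\dots<1^{(r_1)}$ representing point $1$ of $\pi$, then a block of $d_2$ new points, then the run for point $2$, $\dots$, the run for point $n$, then a block of $d_{n+1}$ new points. Define $\tau\in S_N$ by: every point in a block is a fixed point; $\tau(q^{(s)})=q^{(s+1)}$ for $0\le s<r_q$; and $\tau(q^{(r_q)})=\pi(q)^{(0)}$. Color every fixed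 point lying in a block red and color every index $q^{(s)}$, $0\le s<r_q$, yellow (these are successions); nothing else is colored. -}

module Defs where

open import Level using (Level)
open import Data.Bool using (Bool; true; false; _∧_; if_then_else_)
open import Data.Nat using (ℕ; zero; suc; _+_; _∸_; _≤ᵇ_; _≡ᵇ_; _<ᵇ_; _<?_)
open import Data.Fin using (Fin; toℕ; fromℕ<)
import Data.Fin as F
open import Data.List using (List; []; _∷_; allFin; _++_; map; replicate; concatMap; upTo; length; foldr)
open import Data.Vec.Functional using (Vector) renaming ([] to []ᵥ; _∷_ to _∷ᵥ_)
open import Data.Fin.Permutation using (Permutation′; _⟨$⟩ʳ_)
open import Relation.Nullary using (yes; no)
open import Algebra.Bundles using (CommutativeRing)

-- Generic combinatorial helpers (positions are 0-indexed naturals)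

count : ℕ → (ℕ → Bool) → ℕ
count zero    P = 0
count (suc N) P = count N P + (if P N then 1 else 0)

allB : (ℕ → Bool) → List ℕ → Bool
allB P []       = true
allB P (x ∷ xs) = P x ∧ allB P xs

iter : (ℕ → ℕ) → ℕ → ℕ → ℕ
iter σ zero    i = i
iter σ (suc k) i = σ (iter σ k i)

-- number of cycles of a permutation σ of {0,…,N-1}: each cycle is counted
-- via its least element (i is least in its cycle iff i ≤ σ^k(i) for all k < N)
cycles : ℕ → (ℕ → ℕ) → ℕ
cycles N σ = count N (λ i → allB (λ k → i ≤ᵇ iter σ k i) (upTo N))

toℕMap : {n : ℕ} → (Fin n → Fin n) → ℕ → ℕ
toℕMap {n} σ k with k <? n
... | yes k<n = toℕ (σ (fromℕ< k<n))
... | no  _   = k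

-- f(π): number of cycles of π ∈ S_n
cyclesPerm : {n : ℕ} → Permutation′ n → ℕ
cyclesPerm {n} π = cycles n (toℕMap (π ⟨$⟩ʳ_))

sumF : {m : ℕ} → Vector ℕ m → ℕ
sumF {zero}  v = 0
sumF {suc m} v = v F.zero + sumF (λ i → v (F.suc i))

box : (m B : ℕ) → List (Vector ℕ m)
box zero    B = []ᵥ ∷ []
box (suc m) B = concatMap (λ v → map (λ w → v ∷ᵥ w) (box m B)) (upTo (suc B))

-- what sits at a position: a point of a block of new points, or q^(s)
data Label (n : ℕ) : Set where
  blk : Label n
  run : Fin n → ℕ → Label n

labelEq : {n : ℕ} → Label n → Label n → Bool
labelEq blk       blk       = true
labelEq blk       (run _ _) = false
labelEq (run _ _) blk       = false
labelEq (run q s) (run q′ s′) = (toℕ q ≡ᵇ toℕ q′) ∧ (s ≡ᵇ s′)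

-- the row of positions: d₁ block, run of point 1, d₂ block, …, run of n, d_{n+1} block
-- (d (F.zero) = d₁, d (F.suc q) = d_{q+2}, r q = r_{q+1})
layout : (n : ℕ) → Vector ℕ (suc n) → Vector ℕ n → List (Label n)
layout n d r =
  replicate (d F.zero) blk ++
  concatMap (λ q → map (run q) (upTo (suc (r q))) ++ replicate (d (F.suc q)) blk)
            (allFin n)

at : {n : ℕ} → List (Label n) → ℕ → Label n
at []       _       = blk
at (x ∷ xs) zero    = x
at (x ∷ xs) (suc p) = at xs p

indexOf : {n : ℕ} → Label n → List (Label n) → ℕ
indexOf ℓ []       = 0
indexOf ℓ (x ∷ xs) = if labelEq ℓ x then 0 else suc (indexOf ℓ xs)

sizeN : (n : ℕ) → Vector ℕ (suc n) → Vector ℕ n → ℕ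
sizeN n d r = n + sumF d + sumF r

tau : (n : ℕ) → Permutation′ n → Vector ℕ (suc n) → Vector ℕ n → ℕ → ℕ
tau n π d r p with at (layout n d r) p
... | blk     = p
... | run q s = if s <ᵇ r q then indexOf (run q (suc s)) (layout n d r)
                             else indexOf (run (π ⟨$⟩ʳ q) 0) (layout n d r)

red : (n : ℕ) → Vector ℕ (suc n) → Vector ℕ n → ℕ → Bool
red n d r p with at (layout n d r) p
... | blk     = true
... | run _ _ = false

yellow : (n : ℕ) → Vector ℕ (suc n) → Vector ℕ n → ℕ → Bool
yellow n d r p with at (layout n d r) p
... | blk     = false
... | run q s = s <ᵇ r q

module _ {c ℓ : Level} (R : CommutativeRing c ℓ) where
  open CommutativeRing R using (Carrier; 0#; 1#) renaming (_+_ to _+R_; _*_ to _*R_)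

  pow : Carrier → ℕ → Carrier
  pow a zero    = 1#
  pow a (suc k) = a *R pow a k

  rsum : List Carrier → Carrier
  rsum = foldr _+R_ 0#

  Series : Set c
  Series = ℕ → Carrier

  _⊛_ : Series → Series → Series
  (f ⊛ g) N = rsum (map (λ i → f i *R g (N ∸ i)) (upTo (suc N)))

  oneS : Series
  oneS zero    = 1#
  oneS (suc _) = 0#

  constS : Carrier → Series
  constS a zero    = a
  constS a (suc _) = 0#

  xpowS : ℕ → Series
  xpowS n k = if k ≡ᵇ n then 1# else 0#

  powS : Series → ℕ → Series
  powS f zero    = oneS
  powS f (suc m) = f ⊛ powS f m

  -- 1/(1 - a x) = Σ_k a^k x^k
  invOneMinus : Carrier → Series
  invOneMinus a k = pow a k

  -- W₁-weight of a colored permutation (τ, red set, yellow set) on N points,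
  -- without the factor x^N:  α^{f(τ)} t^{#red fixed pts} u^{#yellow i with τ(i)=i+1}
  W1coeff : Carrier → Carrier → Carrier →
            (N : ℕ) → (ℕ → ℕ) → (ℕ → Bool) → (ℕ → Bool) → Carrier
  W1coeff α t u N τ rd yl =
    pow α (cycles N τ) *R
    (pow t (count N (λ i → rd i ∧ (τ i ≡ᵇ i))) *R
     pow u (count N (λ i → yl i ∧ (τ i ≡ᵇ suc i))))

  -- Σ over all (d, r) of the W₁-weights x^N α^… t^… u^…, as a power series in x:
  -- the coefficient of x^M sums over all (d, r) with N = M (entries are then ≤ M)
  weightSum : Carrier → Carrier → Carrier → (n : ℕ) → Permutation′ n → Series
  weightSum α t u n π M =
    rsum (concatMap (λ d → map (λ r →
            if sizeN n d r ≡ᵇ M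
            then W1coeff α t u (sizeN n d r) (tau n π d r) (red n d r) (yellow n d r)
            else 0#)
          (box n M)) (box (suc n) M))

  rhsSeries : Carrier → Carrier → Carrier → (n : ℕ) → Permutation′ n → Series
  rhsSeries α t u n π =
    xpowS n ⊛ (constS (pow α (cyclesPerm π)) ⊛
      (powS (invOneMinus (α *R t)) (suc n) ⊛ powS (invOneMinus u) n))

module Submission where

-- Fix (d, r) and let τ be the permutation built from it, of size
-- N = n + Σd + Σr.  Its red fixed points are the Σd block points, its yellow
-- successions are the Σr indices q⁽ˢ⁾ with s < r_q, and its cycles are the Σd
-- fixed points of blocks plus one cycle for each cycle of π (the τ-cycle
-- through q⁽⁰⁾ runs along the runs of the π-cycle of q).  Cycles are counted
-- by their least elements, so this last count compares least elements of
-- τ-cycles and π-cycles, using that for an injective self-map of [0,N) the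
-- finite test of `cycles` detects least elements of whole cycles (Counting,
-- PermutationOnℕ; the construction itself is in Layout, Tau, Statistics).
-- Hence each weight is α^{f(π)} (αt)^{Σd} u^{Σr} (module Weight), and the
-- theorem becomes the power-series identity of SeriesAlgebra.DoubleSum:
-- summing a^{Σv} over vectors v ∈ ℕᵐ with prescribed Σv gives the
-- coefficients of (1 - ax)⁻ᵐ.

open import Defs
open import Level using (Level)
open import Data.Empty using (⊥-elim)
open import Data.Bool using (Bool; true; false; _∧_; if_then_else_)
open import Data.Nat.Base using (ℕ; zero; suc)
open import Data.Vec.Functional using (Vector)
open import Data.Fin.Permutation using (Permutation′)
open import Algebra.Bundles using (CommutativeRing)
open import Relation.Nullary using (¬_; Dec; yes; no; does)
open import Relation.Nullary.Decidable using (dec-true; dec-false)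
import Relation.Binary.PropositionalEquality as ≡
open ≡ using (_≡_)

-- Boolean tests of Defs (_≡ᵇ_, _<ᵇ_, _≤ᵇ_) are definitionally the `does`
-- of the standard decision procedures; this lets us evaluate them.
module BooleanTests where
  open import Data.Nat.Base using (_≤_; _<_; _≤ᵇ_; _≡ᵇ_; _<ᵇ_)
  open import Data.Nat.Properties using (_≟_; _<?_; _≤?_)
  open import Data.Product using (_×_; _,_)
  open ≡ using (refl)

  does-sound : ∀ {p} {P : Set p} (P? : Dec P) → does P? ≡ true → P
  does-sound (yes p) _ = p

  ≡ᵇ-true : ∀ {m n} → m ≡ n → (m ≡ᵇ n) ≡ true
  ≡ᵇ-true {m} {n} = dec-true (m ≟ n)

  ≡ᵇ-false : ∀ {m n} → ¬ m ≡ n → (m ≡ᵇ n) ≡ false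
  ≡ᵇ-false {m} {n} = dec-false (m ≟ n)

  ≡ᵇ-sound : ∀ {m n} → (m ≡ᵇ n) ≡ true → m ≡ n
  ≡ᵇ-sound {m} {n} = does-sound (m ≟ n)

  <ᵇ-true : ∀ {m n} → m < n → (m <ᵇ n) ≡ true
  <ᵇ-true {m} {n} = dec-true (m <? n)

  <ᵇ-false : ∀ {m n} → ¬ m < n → (m <ᵇ n) ≡ false
  <ᵇ-false {m} {n} = dec-false (m <? n)

  ≤ᵇ-true : ∀ {m n} → m ≤ n → (m ≤ᵇ n) ≡ true
  ≤ᵇ-true {m} {n} = dec-true (m ≤? n)

  ≤ᵇ-false : ∀ {m n} → ¬ m ≤ n → (m ≤ᵇ n) ≡ false
  ≤ᵇ-false {m} {n} = dec-false (m ≤? n)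

  ≤ᵇ-sound : ∀ {m n} → (m ≤ᵇ n) ≡ true → m ≤ n
  ≤ᵇ-sound {m} {n} = does-sound (m ≤? n)

  ∧-true : ∀ {a b} → (a ∧ b) ≡ true → a ≡ true × b ≡ true
  ∧-true {true} {true} _ = refl , refl

  true-iff : ∀ {a b : Bool} → (a ≡ true → b ≡ true) → (b ≡ true → a ≡ true) → a ≡ b
  true-iff {true}  {true}  _ _ = refl
  true-iff {true}  {false} f _ = ≡.sym (f refl)
  true-iff {false} {true}  _ g = g refl
  true-iff {false} {false} _ _ = refl

  not-true : ∀ {b : Bool} → ¬ b ≡ true → b ≡ false
  not-true {true}  h = ⊥-elim (h refl)
  not-true {false} _ = refl

-- Counting, iteration and cycle minima on ℕ.
module Counting where
  open BooleanTests
  open import Data.Nat.Base using (_+_; _∸_; _≤_; _<_; z≤n; s≤s; s≤s⁻¹; _<ᵇ_)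
  open import Data.Nat.Properties
  open import Data.Fin using (toℕ; fromℕ<)
  import Data.Fin.Properties as FP
  open import Data.List using (applyUpTo)
  open import Data.Product using (∃; _×_; _,_; proj₁; proj₂)
  open import Data.Sum using (inj₁; inj₂)
  open ≡ using (refl; sym; trans; cong; cong₂; subst)

  b2n : Bool → ℕ
  b2n b = if b then 1 else 0

  count-cong : ∀ N {P Q : ℕ → Bool} → (∀ i → i < N → P i ≡ Q i) → count N P ≡ count N Q
  count-cong zero    h = refl
  count-cong (suc N) h = cong₂ (λ a b → a + b2n b) (count-cong N (λ i i<N → h i (m<n⇒m<1+n i<N))) (h N ≤-refl)

  count-cons : ∀ N (P : ℕ → Bool) → count (suc N) P ≡ b2n (P 0) + count N (λ i → P (suc i))
  count-cons zero    P = +-comm 0 (b2n (P 0))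
  count-cons (suc N) P = trans (cong (_+ b2n (P (suc N))) (count-cons N P)) (+-assoc (b2n (P 0)) _ _)

  count-none : ∀ N (P : ℕ → Bool) → (∀ i → P i ≡ false) → count N P ≡ 0
  count-none zero    P h = refl
  count-none (suc N) P h rewrite h N | count-none N P h = refl

  count-all : ∀ N (P : ℕ → Bool) → (∀ i → P i ≡ true) → count N P ≡ N
  count-all zero    P h = refl
  count-all (suc N) P h rewrite h N | count-all N P h = +-comm N 1

  count-below : ∀ R k → k ≤ R → count k (λ s → s <ᵇ R) ≡ k
  count-below R zero    _  = refl
  count-below R (suc k) le rewrite count-below R k (<⇒≤ le) | <ᵇ-true le = +-comm k 1

  count-sumF : ∀ m (f : ℕ → Bool) → count m f ≡ sumF {m} (λ q → b2n (f (toℕ q)))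
  count-sumF zero    f = refl
  count-sumF (suc m) f = trans (count-cons m f) (cong (b2n (f 0) +_) (count-sumF m (λ i → f (suc i))))

  allB-intro : ∀ N (f : ℕ → ℕ) (P : ℕ → Bool) → (∀ k → k < N → P (f k) ≡ true) →
               allB P (applyUpTo f N) ≡ true
  allB-intro zero    f P h = refl
  allB-intro (suc N) f P h rewrite h 0 (s≤s z≤n) =
    allB-intro N (λ k → f (suc k)) P (λ k k<N → h (suc k) (s≤s k<N))

  allB-elim : ∀ N (f : ℕ → ℕ) (P : ℕ → Bool) → allB P (applyUpTo f N) ≡ true →
              ∀ k → k < N → P (f k) ≡ true
  allB-elim (suc N) f P e zero    _         = proj₁ (∧-true e)
  allB-elim (suc N) f P e (suc k) (s≤s k<N) = allB-elim N (λ k → f (suc k)) P (proj₂ (∧-true e)) k k<N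

  iter-+ : ∀ (σ : ℕ → ℕ) a b i → iter σ (a + b) i ≡ iter σ a (iter σ b i)
  iter-+ σ zero    b i = refl
  iter-+ σ (suc a) b i = cong σ (iter-+ σ a b i)

  iter-sucʳ : ∀ (σ : ℕ → ℕ) k i → iter σ (suc k) i ≡ iter σ k (σ i)
  iter-sucʳ σ zero    i = refl
  iter-sucʳ σ (suc k) i = cong σ (iter-sucʳ σ k i)

  iter-fixed : ∀ (σ : ℕ → ℕ) k i → σ i ≡ i → iter σ k i ≡ i
  iter-fixed σ zero    i e = refl
  iter-fixed σ (suc k) i e = trans (cong σ (iter-fixed σ k i e)) e

  -- For an injective self-map σ of [0,N) every orbit is a cycle of length ≤ N.
  -- Hence the test used by `cycles` (i ≤ σᵏ i for all k < N) already says
  -- that i is the least element of its whole cycle.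
  module CycleMinimum (σ : ℕ → ℕ) (N : ℕ) (into : ∀ {i} → i < N → σ i < N)
                      (inj : ∀ {i j} → i < N → j < N → σ i ≡ σ j → i ≡ j) where

    iter-< : ∀ {i} k → i < N → iter σ k i < N
    iter-< zero    i<N = i<N
    iter-< (suc k) i<N = into (iter-< k i<N)

    iter-cancel : ∀ {i} a b → i < N → iter σ a i ≡ iter σ (a + b) i → iter σ b i ≡ i
    iter-cancel zero    b i<N e = sym e
    iter-cancel (suc a) b i<N e = iter-cancel a b i<N (inj (iter-< a i<N) (iter-< (a + b) i<N) e)

    -- by pigeonhole, two of σ⁰ i, …, σᴺ i coincide; cancelling gives a return time
    return-time : ∀ {i} → i < N → ∃ λ p → 0 < p × p ≤ N × iter σ p i ≡ i
    return-time {i} i<N with FP.pigeonhole (n<1+n N) (λ j → fromℕ< (iter-< {i} (toℕ j) i<N))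
    ... | a , b , a<b , e = toℕ b ∸ toℕ a , m<n⇒0<n∸m a<b ,
          ≤-trans (m∸n≤m (toℕ b) (toℕ a)) (s≤s⁻¹ (FP.toℕ<n b)) ,
          iter-cancel (toℕ a) (toℕ b ∸ toℕ a) i<N
            (trans same (cong (λ z → iter σ z i) (sym (m+[n∸m]≡n (<⇒≤ a<b)))))
      where
        same : iter σ (toℕ a) i ≡ iter σ (toℕ b) i
        same = trans (sym (FP.toℕ-fromℕ< (iter-< (toℕ a) i<N)))
                     (trans (cong toℕ e) (FP.toℕ-fromℕ< (iter-< (toℕ b) i<N)))

    within-period : ∀ {i} p → 0 < p → iter σ p i ≡ i → ∀ k → ∃ λ k′ → k′ < p × iter σ k i ≡ iter σ k′ i
    within-period p p>0 e zero = 0 , p>0 , refl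
    within-period {i} p p>0 e (suc k) with within-period p p>0 e k
    ... | k′ , k′<p , e′ with m≤n⇒m<n∨m≡n k′<p
    ...   | inj₁ lt = suc k′ , lt , cong σ e′
    ...   | inj₂ eq = 0 , p>0 , trans (cong σ e′) (trans (cong (λ z → iter σ z i) eq) e)

    least-in-cycle : ∀ {i} → i < N → (∀ k → k < N → i ≤ iter σ k i) → ∀ k → i ≤ iter σ k i
    least-in-cycle {i} i<N h k with return-time i<N
    ... | p , p>0 , p≤N , e with within-period p p>0 e k
    ...   | k′ , k′<p , e′ = subst (i ≤_) (sym e′) (h k′ (<-≤-trans k′<p p≤N))

-- Lists of labels: lookup (`at`), search (`indexOf`) and counting.
module LabelLists where
  open BooleanTests
  open Counting using (b2n; count-cons)
  open import Data.Nat.Base using (_+_; _≤_; _<_; z≤n; s≤s)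
  open import Data.Nat.Properties using (+-assoc)
  open import Data.Fin using (Fin; toℕ)
  import Data.Fin as F
  open import Data.List using (List; []; _∷_; _++_; replicate; concatMap; applyUpTo; length; tabulate)
  open import Data.List.Relation.Unary.All using (All; []; _∷_)
  open import Data.Product using (∃; _×_; _,_)
  open import Data.Sum using (_⊎_; inj₁; inj₂)
  open ≡ using (refl; sym; trans; cong)

  lcount : {A : Set} → (A → Bool) → List A → ℕ
  lcount h []       = 0
  lcount h (x ∷ xs) = b2n (h x) + lcount h xs

  lcount-++ : {A : Set} (h : A → Bool) (xs ys : List A) → lcount h (xs ++ ys) ≡ lcount h xs + lcount h ys
  lcount-++ h []       ys = refl
  lcount-++ h (x ∷ xs) ys = trans (cong (b2n (h x) +_) (lcount-++ h xs ys)) (sym (+-assoc (b2n (h x)) _ _))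

  lcount-applyUpTo : {A : Set} (h : A → Bool) (f : ℕ → A) (k : ℕ) → lcount h (applyUpTo f k) ≡ count k (λ j → h (f j))
  lcount-applyUpTo h f zero    = refl
  lcount-applyUpTo h f (suc k) =
    trans (cong (b2n (h (f 0)) +_) (lcount-applyUpTo h (λ j → f (suc j)) k)) (sym (count-cons k (λ j → h (f j))))

  lcount-replicate : {A : Set} (h : A → Bool) (k : ℕ) (x : A) → lcount h (replicate k x) ≡ count k (λ _ → h x)
  lcount-replicate h zero    x = refl
  lcount-replicate h (suc k) x = trans (cong (b2n (h x) +_) (lcount-replicate h k x)) (sym (count-cons k (λ _ → h x)))

  lcount-concatMap : {A B : Set} (h : A → Bool) {m : ℕ} (F : B → List A) (g : Fin m → B) →
                     lcount h (concatMap F (tabulate g)) ≡ sumF (λ q → lcount h (F (g q)))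
  lcount-concatMap h {zero}  F g = refl
  lcount-concatMap h {suc m} F g =
    trans (lcount-++ h (F (g F.zero)) _) (cong (lcount h (F (g F.zero)) +_) (lcount-concatMap h F (λ q → g (F.suc q))))

  length-lcount : {A : Set} (xs : List A) → length xs ≡ lcount (λ _ → true) xs
  length-lcount []       = refl
  length-lcount (x ∷ xs) = cong suc (length-lcount xs)

  module _ {n : ℕ} where
    count-at : ∀ h (L : List (Label n)) → count (length L) (λ i → h (at L i)) ≡ lcount h L
    count-at h []       = refl
    count-at h (x ∷ xs) = trans (count-cons (length xs) (λ i → h (at (x ∷ xs) i))) (cong (b2n (h x) +_) (count-at h xs))

    at-++ˡ : ∀ (xs ys : List (Label n)) i → i < length xs → at (xs ++ ys) i ≡ at xs i
    at-++ˡ (x ∷ xs) ys zero    _       = refl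
    at-++ˡ (x ∷ xs) ys (suc i) (s≤s p) = at-++ˡ xs ys i p

    at-++ʳ : ∀ (xs ys : List (Label n)) j → at (xs ++ ys) (length xs + j) ≡ at ys j
    at-++ʳ []       ys j = refl
    at-++ʳ (x ∷ xs) ys j = at-++ʳ xs ys j

    at-++-cases : ∀ (xs ys : List (Label n)) i → i < length (xs ++ ys) →
      (i < length xs × at (xs ++ ys) i ≡ at xs i) ⊎
      (∃ λ j → i ≡ length xs + j × j < length ys × at (xs ++ ys) i ≡ at ys j)
    at-++-cases []       ys i       p       = inj₂ (i , refl , p , refl)
    at-++-cases (x ∷ xs) ys zero    p       = inj₁ (s≤s z≤n , refl)
    at-++-cases (x ∷ xs) ys (suc i) (s≤s p) with at-++-cases xs ys i p
    ... | inj₁ (a , b)         = inj₁ (s≤s a , b)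
    ... | inj₂ (j , e , a , b) = inj₂ (j , cong suc e , a , b)

    at-applyUpTo : ∀ (f : ℕ → Label n) k j → j < k → at (applyUpTo f k) j ≡ f j
    at-applyUpTo f (suc k) zero    _       = refl
    at-applyUpTo f (suc k) (suc j) (s≤s p) = at-applyUpTo (λ x → f (suc x)) k j p

    at-All : ∀ {P : Label n → Set} (xs : List (Label n)) i → All P xs → i < length xs → P (at xs i)
    at-All (x ∷ xs) zero    (px ∷ _)   _       = px
    at-All (x ∷ xs) (suc i) (_  ∷ pxs) (s≤s p) = at-All xs i pxs p

    labelEq-refl : ∀ (ℓ : Label n) → labelEq ℓ ℓ ≡ true
    labelEq-refl blk       = refl
    labelEq-refl (run q s) rewrite ≡ᵇ-true {toℕ q} refl | ≡ᵇ-true {s} refl = refl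

    indexOf-first : ∀ (ℓ : Label n) (L : List (Label n)) i → at L i ≡ ℓ → i < length L →
                    (∀ i′ → i′ < i → labelEq ℓ (at L i′) ≡ false) → indexOf ℓ L ≡ i
    indexOf-first ℓ (x ∷ L) zero    e _       h rewrite e | labelEq-refl ℓ = refl
    indexOf-first ℓ (x ∷ L) (suc i) e (s≤s p) h rewrite h 0 (s≤s z≤n) =
      cong suc (indexOf-first ℓ L i e p (λ i′ lt → h (suc i′) (s≤s lt)))

-- The row of positions built from (d, r), and where each label sits in it.
module Layout where
  open BooleanTests
  open Counting using (count-all)
  open LabelLists
  open import Data.Unit using (⊤; tt)
  open import Data.Nat.Base using (_+_; _∸_; _≤_; _<_; z≤n; s≤s; s≤s⁻¹)
  open import Data.Nat.Properties
  open import Data.Fin using (Fin; toℕ)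
  import Data.Fin as F
  open import Data.List using (List; []; _∷_; _++_; map; replicate; concatMap; upTo; length; tabulate; allFin)
  open import Data.List.Properties using (map-tabulate; map-++; concatMap-++; ++-assoc; map-applyUpTo; length-map; length-applyUpTo; length-++)
  open import Data.List.Relation.Unary.All using (All; []; _∷_)
  import Data.List.Relation.Unary.All as All
  open import Data.List.Relation.Unary.All.Properties using (map⁺; ++⁺; concat⁺; applyUpTo⁺₂; tabulate⁺; replicate⁺)
  open import Data.Product using (Σ; _×_; _,_; proj₁; proj₂)
  open import Data.Sum using (inj₁; inj₂)
  open import Relation.Nullary using (yes; no)
  open import Algebra.Properties.CommutativeSemigroup +-commutativeSemigroup using (interchange; x∙yz≈y∙xz)
  open ≡ using (refl; sym; trans; cong; cong₂; subst; subst₂; module ≡-Reasoning)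

  sumF-cong : ∀ {m} (a b : Vector ℕ m) → (∀ q → a q ≡ b q) → sumF a ≡ sumF b
  sumF-cong {zero}  a b h = refl
  sumF-cong {suc m} a b h = cong₂ _+_ (h F.zero) (sumF-cong (λ q → a (F.suc q)) (λ q → b (F.suc q)) (λ q → h (F.suc q)))

  sumF-+ : ∀ {m} (a b : Vector ℕ m) → sumF (λ q → a q + b q) ≡ sumF a + sumF b
  sumF-+ {zero}  a b = refl
  sumF-+ {suc m} a b = trans (cong (a F.zero + b F.zero +_) (sumF-+ (λ q → a (F.suc q)) (λ q → b (F.suc q))))
                             (interchange (a F.zero) (b F.zero) _ _)

  sumF-suc : ∀ {m} (a : Vector ℕ m) → sumF (λ q → suc (a q)) ≡ m + sumF a
  sumF-suc {zero}  a = refl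
  sumF-suc {suc m} a = cong suc (trans (cong (a F.zero +_) (sumF-suc (λ q → a (F.suc q))))
                                       (x∙yz≈y∙xz (a F.zero) m _))

  Earlier : {n : ℕ} → Fin n → Label n → Set
  Earlier q blk        = ⊤
  Earlier q (run q′ _) = toℕ q′ < toℕ q

  Later : {n : ℕ} → Fin n → Label n → Set
  Later q blk        = ⊤
  Later q (run q′ _) = toℕ q < toℕ q′

  allFin-split : ∀ {n} (q : Fin n) → Σ (List (Fin n)) λ as → Σ (List (Fin n)) λ bs →
     allFin n ≡ as ++ q ∷ bs × All (λ q′ → toℕ q′ < toℕ q) as × All (λ q′ → toℕ q < toℕ q′) bs
  allFin-split {suc n} F.zero    = [] , tabulate F.suc , refl , [] , tabulate⁺ (λ i → s≤s z≤n)
  allFin-split {suc n} (F.suc q) with allFin-split q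
  ... | as , bs , e , pa , pb =
    F.zero ∷ map F.suc as , map F.suc bs , cong (F.zero ∷_) shifted ,
    s≤s z≤n ∷ map⁺ (All.map s≤s pa) , map⁺ (All.map s≤s pb)
    where shifted : tabulate F.suc ≡ map F.suc as ++ F.suc q ∷ map F.suc bs
          shifted = trans (sym (map-tabulate (λ x → x) F.suc)) (trans (cong (map F.suc) e) (map-++ F.suc as (q ∷ bs)))

  run-injective : ∀ {n} {q q′ : Fin n} {s s′} → run q s ≡ run q′ s′ → q ≡ q′ × s ≡ s′
  run-injective refl = refl , refl

  blk≢run : ∀ {n} {q : Fin n} {s} → ¬ blk ≡ run q s
  blk≢run ()

  module _ (n : ℕ) (d : Vector ℕ (suc n)) (r : Vector ℕ n) where
    private
      L : List (Label n)
      L = layout n d r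

      N : ℕ
      N = sizeN n d r

    runOf : Fin n → List (Label n)
    runOf q = map (run q) (upTo (suc (r q)))

    segment : Fin n → List (Label n)
    segment q = runOf q ++ replicate (d (F.suc q)) blk

    lcount-layout : ∀ h → lcount h L ≡ count (d F.zero) (λ _ → h blk) +
        sumF (λ q → count (suc (r q)) (λ s → h (run q s)) + count (d (F.suc q)) (λ _ → h blk))
    lcount-layout h = begin
      lcount h L                                      ≡⟨ lcount-++ h (replicate (d F.zero) blk) _ ⟩
      lcount h (replicate (d F.zero) blk) + lcount h (concatMap segment (allFin n))
        ≡⟨ cong₂ _+_ (lcount-replicate h (d F.zero) blk) (lcount-concatMap h segment (λ x → x)) ⟩
      _ + sumF (λ q → lcount h (segment q))            ≡⟨ cong (count (d F.zero) (λ _ → h blk) +_) (sumF-cong _ _ per-segment) ⟩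
      _ ∎
      where
        open ≡-Reasoning
        per-segment : ∀ q → lcount h (segment q) ≡ count (suc (r q)) (λ s → h (run q s)) + count (d (F.suc q)) (λ _ → h blk)
        per-segment q = trans (lcount-++ h (runOf q) _) (cong₂ _+_
          (trans (cong (lcount h) (map-applyUpTo (λ x → x) (run q) (suc (r q)))) (lcount-applyUpTo h (run q) (suc (r q))))
          (lcount-replicate h (d (F.suc q)) blk))

    length-layout : length L ≡ N
    length-layout = begin
      length L                                               ≡⟨ length-lcount L ⟩
      lcount (λ _ → true) L                                  ≡⟨ lcount-layout (λ _ → true) ⟩
      count (d F.zero) (λ _ → true) + sumF (λ q → count (suc (r q)) (λ _ → true) + count (d (F.suc q)) (λ _ → true))
        ≡⟨ cong₂ _+_ (all (d F.zero)) (sumF-cong _ _ (λ q → cong₂ _+_ (all (suc (r q))) (all (d (F.suc q))))) ⟩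
      d F.zero + sumF (λ q → suc (r q) + d (F.suc q))       ≡⟨ cong (d F.zero +_) (sumF-+ (λ q → suc (r q)) (λ q → d (F.suc q))) ⟩
      d F.zero + (sumF (λ q → suc (r q)) + D′)               ≡⟨ cong (λ z → d F.zero + (z + D′)) (sumF-suc r) ⟩
      d F.zero + ((n + sumF r) + D′)                         ≡⟨ x∙yz≈y∙xz (d F.zero) (n + sumF r) D′ ⟩
      (n + sumF r) + (d F.zero + D′)                         ≡⟨ +-assoc n (sumF r) _ ⟩
      n + (sumF r + sumF d)                                  ≡⟨ cong (n +_) (+-comm (sumF r) (sumF d)) ⟩
      n + (sumF d + sumF r)                                  ≡⟨ sym (+-assoc n (sumF d) (sumF r)) ⟩
      N ∎
      where open ≡-Reasoning
            D′ = sumF (λ q → d (F.suc q))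
            all : ∀ k → count k (λ _ → true) ≡ k
            all k = count-all k _ (λ _ → refl)

    pos : Fin n → ℕ → ℕ
    pos q s = indexOf (run q s) L

    -- Everything about point q follows from cutting the row as
    -- pre ++ runOf q ++ post, with only earlier points in pre and later in post.
    module AtPoint (q : Fin n) where
      private
        R = d (F.suc q)
        split = allFin-split q
        as = proj₁ split
        bs = proj₁ (proj₂ split)

      pre post : List (Label n)
      pre  = replicate (d F.zero) blk ++ concatMap segment as
      post = replicate R blk ++ concatMap segment bs

      cut : L ≡ pre ++ (runOf q ++ post)
      cut = begin
        B ++ concatMap segment (allFin n)              ≡⟨ cong (λ z → B ++ concatMap segment z) (proj₁ (proj₂ (proj₂ split))) ⟩
        B ++ concatMap segment (as ++ q ∷ bs)          ≡⟨ cong (B ++_) (concatMap-++ segment as (q ∷ bs)) ⟩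
        B ++ (CA ++ ((runOf q ++ replicate R blk) ++ CB)) ≡⟨ cong (λ z → B ++ (CA ++ z)) (++-assoc (runOf q) _ CB) ⟩
        B ++ (CA ++ (runOf q ++ post))                 ≡⟨ sym (++-assoc B CA _) ⟩
        pre ++ (runOf q ++ post) ∎
        where open ≡-Reasoning
              B = replicate (d F.zero) blk
              CA = concatMap segment as
              CB = concatMap segment bs

      earlier-segment : ∀ {q′} → toℕ q′ < toℕ q → All (Earlier q) (segment q′)
      earlier-segment {q′} lt = ++⁺ (map⁺ {P = Earlier q} {f = run q′} (applyUpTo⁺₂ (λ x → x) (suc (r q′)) (λ _ → lt)))
                                    (replicate⁺ (d (F.suc q′)) tt)

      later-segment : ∀ {q′} → toℕ q < toℕ q′ → All (Later q) (segment q′)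
      later-segment {q′} lt = ++⁺ (map⁺ {P = Later q} {f = run q′} (applyUpTo⁺₂ (λ x → x) (suc (r q′)) (λ _ → lt)))
                                  (replicate⁺ (d (F.suc q′)) tt)

      pre-earlier : All (Earlier q) pre
      pre-earlier = ++⁺ (replicate⁺ _ tt) (concat⁺ (map⁺ (All.map earlier-segment (proj₁ (proj₂ (proj₂ (proj₂ split)))))))

      post-later : All (Later q) post
      post-later = ++⁺ (replicate⁺ _ tt) (concat⁺ (map⁺ (All.map later-segment (proj₂ (proj₂ (proj₂ (proj₂ split)))))))

      at-cut : ∀ i → at L i ≡ at (pre ++ (runOf q ++ post)) i
      at-cut i = cong (λ z → at z i) cut

      length-runOf : length (runOf q) ≡ suc (r q)
      length-runOf = trans (length-map (run q) (upTo (suc (r q)))) (length-applyUpTo (λ x → x) (suc (r q)))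

      length-cut : N ≡ length (pre ++ (runOf q ++ post))
      length-cut = trans (sym length-layout) (cong length cut)

      at-runOf : ∀ j → j ≤ r q → at (runOf q) j ≡ run q j
      at-runOf j le = trans (cong (λ z → at z j) (map-applyUpTo (λ x → x) (run q) (suc (r q))))
                            (at-applyUpTo (run q) (suc (r q)) j (s≤s le))

      at-offset : ∀ j → j ≤ r q → at L (length pre + j) ≡ run q j
      at-offset j le = trans (at-cut _) (trans (at-++ʳ pre _ j)
        (trans (at-++ˡ (runOf q) post j (subst (j <_) (sym length-runOf) (s≤s le))) (at-runOf j le)))

      offset-< : ∀ j → j ≤ r q → length pre + j < N
      offset-< j le = subst (length pre + j <_) (sym lengths)
                        (+-monoʳ-< (length pre) (≤-trans (s≤s le) (m≤m+n (suc (r q)) (length post))))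
        where lengths : N ≡ length pre + (suc (r q) + length post)
              lengths = trans length-cut (trans (length-++ pre) (cong (length pre +_)
                          (trans (length-++ (runOf q)) (cong (_+ length post) length-runOf))))

      -- q⁽ˢ⁾ first occurs at offset s after pre: earlier entries are earlier
      -- points, blocks, or q⁽ʲ⁾ with j < s
      pos-offset : ∀ s → s ≤ r q → pos q s ≡ length pre + s
      pos-offset s le = indexOf-first (run q s) L (length pre + s) (at-offset s le)
                          (subst (length pre + s <_) (sym length-layout) (offset-< s le)) earlier
        where
          differs : ∀ x → Earlier q x → labelEq (run q s) x ≡ false
          differs blk         _  = refl
          differs (run q′ s′) lt rewrite ≡ᵇ-false {toℕ q} {toℕ q′} (λ e → <-irrefl (sym e) lt) = refl
          earlier : ∀ i′ → i′ < length pre + s → labelEq (run q s) (at L i′) ≡ false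
          earlier i′ lt with i′ <? length pre
          ... | yes p = trans (cong (labelEq (run q s)) (trans (at-cut i′) (at-++ˡ pre _ i′ p)))
                              (differs (at pre i′) (at-All pre i′ pre-earlier p))
          ... | no np = subst (λ z → labelEq (run q s) (at L z) ≡ false) (m+[n∸m]≡n (≮⇒≥ np)) same-point
            where
              j = i′ ∸ length pre
              j<s : j < s
              j<s = +-cancelˡ-< (length pre) j s (subst (_< length pre + s) (sym (m+[n∸m]≡n (≮⇒≥ np))) lt)
              same-point : labelEq (run q s) (at L (length pre + j)) ≡ false
              same-point rewrite at-offset j (≤-trans (<⇒≤ j<s) le) | ≡ᵇ-true {toℕ q} refl
                               | ≡ᵇ-false {s} {j} (λ e → <-irrefl (sym e) j<s) = refl

      data Region (i : ℕ) : Set where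
        before : i < pos q 0 → Earlier q (at L i) → Region i
        inside : ∀ s → s ≤ r q → i ≡ pos q s → Region i
        after  : Later q (at L i) → Region i

      region : ∀ i → i < N → Region i
      region i i<N with at-++-cases pre (runOf q ++ post) i (subst (i <_) length-cut i<N)
      ... | inj₁ (lt , e) =
              before (subst (i <_) (trans (sym (+-identityʳ _)) (sym (pos-offset 0 z≤n))) lt)
                     (subst (Earlier q) (sym (trans (at-cut i) e)) (at-All pre i pre-earlier lt))
      ... | inj₂ (j , refl , j< , e) with at-++-cases (runOf q) post j j<
      ...   | inj₁ (j<run , _) = inside j j≤r (sym (pos-offset j j≤r))
        where j≤r = s≤s⁻¹ (subst (j <_) length-runOf j<run)
      ...   | inj₂ (k , _ , k< , e′) = after (subst (Later q) (sym (trans (at-cut i) (trans e e′))) (at-All post k post-later k<))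

    open AtPoint public using (Region; before; inside; after; region; pos-offset; at-offset; offset-<)

    at-pos : ∀ q s → s ≤ r q → at L (pos q s) ≡ run q s
    at-pos q s le = trans (cong (at L) (pos-offset q s le)) (at-offset q s le)

    pos-<N : ∀ q s → s ≤ r q → pos q s < N
    pos-<N q s le = subst (_< N) (sym (pos-offset q s le)) (offset-< q s le)

    pos-suc : ∀ q s → s < r q → pos q (suc s) ≡ suc (pos q s)
    pos-suc q s lt = trans (pos-offset q (suc s) lt) (trans (+-suc _ s) (cong suc (sym (pos-offset q s (<⇒≤ lt)))))

    pos-start-≤ : ∀ q s → s ≤ r q → pos q 0 ≤ pos q s
    pos-start-≤ q s le = subst₂ _≤_ (sym (pos-offset q 0 z≤n)) (sym (pos-offset q s le)) (+-monoʳ-≤ _ z≤n)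

    at-pos-inv : ∀ i q s → i < N → at L i ≡ run q s → s ≤ r q × i ≡ pos q s
    at-pos-inv i q s i<N e with region q i i<N
    ... | before _ earlier rewrite e = ⊥-elim (<-irrefl refl earlier)
    ... | inside s′ le refl with run-injective (trans (sym e) (at-pos q s′ le))
    ...   | _ , refl = le , refl
    at-pos-inv i q s i<N e | after later rewrite e = ⊥-elim (<-irrefl refl later)

    pos-ordered : ∀ q q′ s → toℕ q < toℕ q′ → s ≤ r q → pos q s < pos q′ 0
    pos-ordered q q′ s lt le with region q′ (pos q s) (pos-<N q s le)
    ... | before p _ = p
    ... | inside s′ le′ e with run-injective (trans (sym (at-pos q s le)) (trans (cong (at L) e) (at-pos q′ s′ le′)))
    ...   | refl , _ = ⊥-elim (<-irrefl refl lt)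
    pos-ordered q q′ s lt le | after later rewrite at-pos q s le = ⊥-elim (<-asym lt later)

-- A permutation π of Fin n acting on ℕ through `toℕMap`, as in `cyclesPerm`.
module PermutationOnℕ (n : ℕ) (π : Permutation′ n) where
  open BooleanTests
  open Counting using (allB-elim; module CycleMinimum)
  open import Data.Nat.Base using (_≤_; _<_; _≤ᵇ_)
  open import Data.Nat.Properties using (_<?_)
  open import Data.Fin using (Fin; toℕ; fromℕ<)
  import Data.Fin.Properties as FP
  open import Data.Fin.Permutation using (_⟨$⟩ʳ_; _⟨$⟩ˡ_; inverseˡ)
  open import Data.List using (upTo)
  open import Data.Product using (∃; _,_)
  open ≡ using (refl; sym; trans; cong; subst)

  πF : Fin n → Fin n
  πF = π ⟨$⟩ʳ_

  πF-injective : ∀ {a b} → πF a ≡ πF b → a ≡ b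
  πF-injective e = trans (sym (inverseˡ π)) (trans (cong (π ⟨$⟩ˡ_) e) (inverseˡ π))

  πℕ : ℕ → ℕ
  πℕ = toℕMap πF

  πℕ-< : ∀ k (p : k < n) → πℕ k ≡ toℕ (πF (fromℕ< p))
  πℕ-< k p with k <? n
  ... | yes p′ = cong (λ z → toℕ (πF z)) (FP.toℕ-injective (trans (FP.toℕ-fromℕ< p′) (sym (FP.toℕ-fromℕ< p))))
  ... | no ¬p  = ⊥-elim (¬p p)

  πℕ-toℕ : ∀ q → πℕ (toℕ q) ≡ toℕ (πF q)
  πℕ-toℕ q = trans (πℕ-< (toℕ q) (FP.toℕ<n q)) (cong (λ z → toℕ (πF z)) (FP.fromℕ<-toℕ q (FP.toℕ<n q)))

  πℕ-into : ∀ {i} → i < n → πℕ i < n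
  πℕ-into {i} p = subst (_< n) (sym (πℕ-< i p)) (FP.toℕ<n _)

  πℕ-injective : ∀ {i j} → i < n → j < n → πℕ i ≡ πℕ j → i ≡ j
  πℕ-injective {i} {j} pi pj e = trans (sym (FP.toℕ-fromℕ< pi)) (trans (cong toℕ (πF-injective
    (FP.toℕ-injective (trans (sym (πℕ-< i pi)) (trans e (πℕ-< j pj)))))) (FP.toℕ-fromℕ< pj))

  πⁱ : ℕ → Fin n → Fin n
  πⁱ zero    q = q
  πⁱ (suc k) q = πF (πⁱ k q)

  πⁱ-sucʳ : ∀ k q → πⁱ (suc k) q ≡ πⁱ k (πF q)
  πⁱ-sucʳ zero    q = refl
  πⁱ-sucʳ (suc k) q = cong πF (πⁱ-sucʳ k q)

  iter-πℕ : ∀ k q → iter πℕ k (toℕ q) ≡ toℕ (πⁱ k q)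
  iter-πℕ zero    q = refl
  iter-πℕ (suc k) q = trans (cong πℕ (iter-πℕ k q)) (πℕ-toℕ (πⁱ k q))

  open CycleMinimum πℕ n πℕ-into πℕ-injective

  least-π : Fin n → Bool
  least-π q = allB (λ k → toℕ q ≤ᵇ iter πℕ k (toℕ q)) (upTo n)

  π-returns : ∀ q → ∃ λ p → πⁱ (suc p) q ≡ q
  π-returns q with return-time (FP.toℕ<n q)
  ... | suc p , _ , _ , e = p , FP.toℕ-injective (trans (sym (iter-πℕ (suc p) q)) e)

  least-π-sound : ∀ q → least-π q ≡ true → ∀ k → toℕ q ≤ toℕ (πⁱ k q)
  least-π-sound q e k = subst (toℕ q ≤_) (iter-πℕ k q)
    (least-in-cycle (FP.toℕ<n q) (λ k k<n → ≤ᵇ-sound (allB-elim n (λ x → x) _ e k k<n)) k)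

-- The map τ of the construction: a permutation of [0,N) moving along runs
-- and from the end of the run of q to the start of the run of π q.
module Tau (n : ℕ) (π : Permutation′ n) (d : Vector ℕ (suc n)) (r : Vector ℕ n) where
  open BooleanTests
  open Layout
  open PermutationOnℕ n π using (πF; πF-injective)
  open import Data.Nat.Base using (_≤_; _<_; z≤n; _<ᵇ_)
  open import Data.Nat.Properties using (m≤n⇒m<n∨m≡n; <-irrefl)
  open import Data.Fin using (Fin)
  open import Data.List using (List)
  open import Data.Product using (_,_; proj₁; proj₂)
  open import Data.Sum using (inj₁; inj₂)
  open ≡ using (refl; sym; trans; cong; subst)

  L : List (Label n)
  L = layout n d r

  N : ℕ
  N = sizeN n d r

  τ : ℕ → ℕ
  τ = tau n π d r

  τ-blk : ∀ p → at L p ≡ blk → τ p ≡ p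
  τ-blk p e with at L p
  ... | blk     = refl
  ... | run _ _ = ⊥-elim (blk≢run (sym e))

  τ-along : ∀ p q s → at L p ≡ run q s → s < r q → τ p ≡ pos n d r q (suc s)
  τ-along p q s e lt with at L p
  ... | blk     = ⊥-elim (blk≢run e)
  ... | run q′ s′ with run-injective e
  ...   | refl , refl rewrite <ᵇ-true lt = refl

  τ-end : ∀ p q → at L p ≡ run q (r q) → τ p ≡ pos n d r (πF q) 0
  τ-end p q e with at L p
  ... | blk     = ⊥-elim (blk≢run e)
  ... | run q′ s′ with run-injective e
  ...   | refl , refl rewrite <ᵇ-false {r q} (<-irrefl refl) = refl

  red-blk : ∀ p → at L p ≡ blk → red n d r p ≡ true
  red-blk p e with at L p
  ... | blk     = refl
  ... | run _ _ = ⊥-elim (blk≢run (sym e))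

  red-run : ∀ p q s → at L p ≡ run q s → red n d r p ≡ false
  red-run p q s e with at L p
  ... | blk     = ⊥-elim (blk≢run e)
  ... | run _ _ = refl

  yellow-blk : ∀ p → at L p ≡ blk → yellow n d r p ≡ false
  yellow-blk p e with at L p
  ... | blk     = refl
  ... | run _ _ = ⊥-elim (blk≢run (sym e))

  yellow-run : ∀ p q s → at L p ≡ run q s → yellow n d r p ≡ (s <ᵇ r q)
  yellow-run p q s e with at L p
  ... | blk     = ⊥-elim (blk≢run e)
  ... | run q′ s′ with run-injective e
  ...   | refl , refl = refl

  data View (i : ℕ) : Set where
    in-block : at L i ≡ blk → View i
    in-run   : ∀ q s → s ≤ r q → i ≡ pos n d r q s → View i

  view : ∀ i → i < N → View i
  view i i<N with at L i in e
  ... | blk     = in-block e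
  ... | run q s = in-run q s (proj₁ (at-pos-inv n d r i q s i<N e)) (proj₂ (at-pos-inv n d r i q s i<N e))

  data Step (q : Fin n) (s : ℕ) : Set where
    along : s < r q → τ (pos n d r q s) ≡ pos n d r q (suc s) → Step q s
    jump  : s ≡ r q → τ (pos n d r q s) ≡ pos n d r (πF q) 0 → Step q s

  step : ∀ q s → s ≤ r q → Step q s
  step q s le with m≤n⇒m<n∨m≡n le
  ... | inj₁ lt   = along lt (τ-along _ q s (at-pos n d r q s le) lt)
  ... | inj₂ refl = jump refl (τ-end _ q (at-pos n d r q s le))

  image-label : ∀ {q s} → Step q s → Label n
  image-label {q} {s} (along _ _) = run q (suc s)
  image-label {q}     (jump _ _)  = run (πF q) 0

  at-image : ∀ {q s} (st : Step q s) → at L (τ (pos n d r q s)) ≡ image-label st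
  at-image {q} {s} (along lt e) = trans (cong (at L) e) (at-pos n d r q (suc s) lt)
  at-image {q}     (jump _ e)   = trans (cong (at L) e) (at-pos n d r (πF q) 0 z≤n)

  blk≢image : ∀ {q s} (st : Step q s) → ¬ blk ≡ image-label st
  blk≢image (along _ _) ()
  blk≢image (jump _ _)  ()

  image-label-injective : ∀ {q q′ s s′} (st : Step q s) (st′ : Step q′ s′) →
                          image-label st ≡ image-label st′ → pos n d r q s ≡ pos n d r q′ s′
  image-label-injective (along _ _)    (along _ _)    refl = refl
  image-label-injective (along _ _)    (jump _ _)     ()
  image-label-injective (jump _ _)     (along _ _)    ()
  image-label-injective (jump refl _)  (jump refl _)  e with run-injective e
  ... | e′ , _ with πF-injective e′
  ...   | refl = refl

  τ-into : ∀ {i} → i < N → τ i < N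
  τ-into {i} i<N with view i i<N
  ... | in-block e = subst (_< N) (sym (τ-blk i e)) i<N
  ... | in-run q s le refl with step q s le
  ...   | along lt e = subst (_< N) (sym e) (pos-<N n d r q (suc s) lt)
  ...   | jump _ e   = subst (_< N) (sym e) (pos-<N n d r (πF q) 0 z≤n)

  image-blk : ∀ {i} → at L i ≡ blk → at L (τ i) ≡ blk
  image-blk {i} e = trans (cong (at L) (τ-blk i e)) e

  τ-injective : ∀ {i j} → i < N → j < N → τ i ≡ τ j → i ≡ j
  τ-injective {i} {j} i<N j<N e with view i i<N | view j j<N
  ... | in-block ei | in-block ej = trans (sym (τ-blk i ei)) (trans e (τ-blk j ej))
  ... | in-block ei | in-run q s le refl =
          ⊥-elim (blk≢image (step q s le) (trans (sym (image-blk ei)) (trans (cong (at L) e) (at-image (step q s le)))))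
  ... | in-run q s le refl | in-block ej =
          ⊥-elim (blk≢image (step q s le) (trans (sym (image-blk ej)) (trans (cong (at L) (sym e)) (at-image (step q s le)))))
  ... | in-run q s le refl | in-run q′ s′ le′ refl =
          image-label-injective (step q s le) (step q′ s′ le′)
            (trans (sym (at-image (step q s le))) (trans (cong (at L) e) (at-image (step q′ s′ le′))))

-- The three statistics of the colored permutation built from (π, d, r):
-- #red fixed points = Σd, #yellow successions = Σr, #cycles = f(π) + Σd.
module Statistics (n : ℕ) (π : Permutation′ n) (d : Vector ℕ (suc n)) (r : Vector ℕ n) where
  open BooleanTests
  open Counting
  open LabelLists using (lcount; count-at)
  open Layout
  open PermutationOnℕ n π
  open Tau n π d r
  open import Data.Nat.Base using (_+_; _∸_; _≤_; _<_; z≤n; s≤s; _≤ᵇ_; _≡ᵇ_; _<ᵇ_)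
  open import Data.Nat.Properties
  open import Data.Fin using (Fin; toℕ)
  import Data.Fin as F
  open import Data.Fin.Properties using (toℕ-injective)
  open import Data.List using (upTo)
  open import Data.Product using (∃; ∃₂; _×_; _,_)
  open import Data.Sum using (inj₁; inj₂)
  open import Relation.Nullary using (yes; no)
  open import Algebra.Properties.CommutativeSemigroup +-commutativeSemigroup using (x∙yz≈y∙xz)
  open ≡ using (refl; sym; trans; cong; cong₂; subst; module ≡-Reasoning)

  open CycleMinimum τ N τ-into τ-injective

  private
    p⁰ : Fin n → ℕ
    p⁰ q = pos n d r q 0

  -- from q⁽ˢ⁾ the orbit climbs to the end of the run of q, then jumps to
  -- π(q)⁽⁰⁾; hence the orbit of q⁽⁰⁾ meets the start of every run πʲ q
  climb : ∀ q k s → s + k ≡ r q → iter τ k (pos n d r q s) ≡ pos n d r q (r q)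
  climb q zero    s e = cong (pos n d r q) (trans (sym (+-identityʳ s)) e)
  climb q (suc k) s e = trans (iter-sucʳ τ k _)
    (trans (cong (iter τ k) (τ-along _ q s (at-pos n d r q s le) (subst (s <_) e (m<m+n s (s≤s z≤n)))))
           (climb q k (suc s) (trans (sym (+-suc s k)) e)))
    where le = subst (s ≤_) e (m≤m+n s (suc k))

  to-next-run : ∀ q s → s ≤ r q → ∃ λ k → iter τ k (pos n d r q s) ≡ p⁰ (πF q)
  to-next-run q s le = suc (r q ∸ s) , trans (cong τ (climb q (r q ∸ s) s (m+[n∸m]≡n le)))
                                             (τ-end _ q (at-pos n d r q (r q) ≤-refl))

  to-run : ∀ q j → ∃ λ k → iter τ k (p⁰ q) ≡ p⁰ (πⁱ j q)
  to-run q zero = 0 , refl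
  to-run q (suc j) with to-run q j | to-next-run (πⁱ j q) 0 z≤n
  ... | k , e | k′ , e′ = k′ + k , trans (iter-+ τ k′ k (p⁰ q)) (trans (cong (iter τ k′) e) e′)

  orbit-in-runs : ∀ q k → ∃₂ λ j s → s ≤ r (πⁱ j q) × iter τ k (p⁰ q) ≡ pos n d r (πⁱ j q) s
  orbit-in-runs q zero = 0 , 0 , z≤n , refl
  orbit-in-runs q (suc k) with orbit-in-runs q k
  ... | j , s , le , e with step (πⁱ j q) s le
  ...   | along lt e′ = j , suc s , lt , trans (cong τ e) e′
  ...   | jump _ e′   = suc j , 0 , z≤n , trans (cong τ e) e′

  p⁰-≤ : ∀ q q′ s → toℕ q ≤ toℕ q′ → s ≤ r q′ → p⁰ q ≤ pos n d r q′ s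
  p⁰-≤ q q′ s le le′ with m≤n⇒m<n∨m≡n le
  ... | inj₁ lt = ≤-trans (<⇒≤ (pos-ordered n d r q q′ 0 lt z≤n)) (pos-start-≤ n d r q′ s le′)
  ... | inj₂ e with toℕ-injective e
  ...   | refl = pos-start-≤ n d r q s le′

  least-τ : ℕ → Bool
  least-τ i = allB (λ k → i ≤ᵇ iter τ k i) (upTo N)

  least-τ-sound : ∀ i → i < N → least-τ i ≡ true → ∀ k → i ≤ iter τ k i
  least-τ-sound i i<N e = least-in-cycle i<N (λ k k<N → ≤ᵇ-sound (allB-elim N (λ x → x) _ e k k<N))

  least-τ-blk : ∀ i → at L i ≡ blk → least-τ i ≡ true
  least-τ-blk i e = allB-intro N (λ x → x) _ (λ k _ → ≤ᵇ-true (≤-reflexive (sym (iter-fixed τ k i (τ-blk i e)))))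

  -- q⁽ˢ⁺¹⁾ is not least: its cycle passes through the smaller q⁽⁰⁾
  least-τ-inner : ∀ q s → suc s ≤ r q → least-τ (pos n d r q (suc s)) ≡ false
  least-τ-inner q s le = not-true contra
    where
      contra : ¬ least-τ (pos n d r q (suc s)) ≡ true
      contra e with to-next-run q (suc s) le | π-returns q
      ... | k₁ , e₁ | p , ep with to-run (πF q) p
      ...   | k₂ , e₂ = <-irrefl refl (<-≤-trans start<
                          (subst (pos n d r q (suc s) ≤_) back (least-τ-sound _ (pos-<N n d r q (suc s) le) e (k₂ + k₁))))
        where
          back : iter τ (k₂ + k₁) (pos n d r q (suc s)) ≡ p⁰ q
          back = trans (iter-+ τ k₂ k₁ _) (trans (cong (iter τ k₂) e₁)
                   (trans e₂ (cong (λ z → pos n d r z 0) (trans (sym (πⁱ-sucʳ p q)) ep))))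
          start< : p⁰ q < pos n d r q (suc s)
          start< = subst (p⁰ q <_) (sym (pos-suc n d r q s le)) (s≤s (pos-start-≤ n d r q s (<⇒≤ le)))

  -- q⁽⁰⁾ is least in its τ-cycle iff q is least in its π-cycle, since the
  -- τ-cycle of q⁽⁰⁾ visits exactly the runs of the π-cycle of q, in row order
  least-τ-start : ∀ q → least-τ (p⁰ q) ≡ least-π q
  least-τ-start q = true-iff to from
    where
      to : least-τ (p⁰ q) ≡ true → least-π q ≡ true
      to e = allB-intro n (λ x → x) _ (λ j _ → ≤ᵇ-true (subst (toℕ q ≤_) (sym (iter-πℕ j q)) (least j)))
        where
          least : ∀ j → toℕ q ≤ toℕ (πⁱ j q)
          least j with toℕ q ≤? toℕ (πⁱ j q)
          ... | yes p = p
          ... | no np with to-run q j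
          ...   | k , ek = ⊥-elim (<-irrefl refl (<-≤-trans (pos-ordered n d r (πⁱ j q) q 0 (≰⇒> np) z≤n)
                             (subst (p⁰ q ≤_) ek (least-τ-sound _ (pos-<N n d r q 0 z≤n) e k))))
      from : least-π q ≡ true → least-τ (p⁰ q) ≡ true
      from e = allB-intro N (λ x → x) _ (λ k _ → ≤ᵇ-true (least k))
        where
          least : ∀ k → p⁰ q ≤ iter τ k (p⁰ q)
          least k with orbit-in-runs q k
          ... | j , s , le , ek = subst (p⁰ q ≤_) (sym ek) (p⁰-≤ q (πⁱ j q) s (least-π-sound q e j) le)

  count-by-labels : ∀ (P : ℕ → Bool) (h : Label n → Bool) → (∀ i → i < N → P i ≡ h (at L i)) →
                    count N P ≡ lcount h L
  count-by-labels P h pt = trans (count-cong N pt) (subst (λ z → count z (λ i → h (at L i)) ≡ lcount h L)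
                                                         (length-layout n d r) (count-at h L))

  red-fixed-points : count N (λ i → red n d r i ∧ (τ i ≡ᵇ i)) ≡ sumF d
  red-fixed-points = trans (count-by-labels _ is-blk by-label) (trans (lcount-layout n d r is-blk)
    (cong₂ _+_ (count-all (d F.zero) _ (λ _ → refl))
               (sumF-cong _ _ (λ q → cong₂ _+_ (count-none (suc (r q)) _ (λ _ → refl)) (count-all (d (F.suc q)) _ (λ _ → refl))))))
    where
      is-blk : Label n → Bool
      is-blk blk       = true
      is-blk (run _ _) = false
      by-label : ∀ i → i < N → (red n d r i ∧ (τ i ≡ᵇ i)) ≡ is-blk (at L i)
      by-label i i<N with view i i<N
      ... | in-block e rewrite red-blk i e | τ-blk i e | ≡ᵇ-true {i} refl | e = refl
      ... | in-run q s le refl rewrite red-run _ q s (at-pos n d r q s le) | at-pos n d r q s le = refl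

  yellow-successions : count N (λ i → yellow n d r i ∧ (τ i ≡ᵇ suc i)) ≡ sumF r
  yellow-successions = trans (count-by-labels _ inner-run by-label) (trans (lcount-layout n d r inner-run)
    (cong₂ _+_ (count-none (d F.zero) _ (λ _ → refl))
               (sumF-cong _ _ (λ q → trans (cong₂ _+_ (per-run q) (count-none (d (F.suc q)) _ (λ _ → refl))) (+-identityʳ (r q))))))
    where
      inner-run : Label n → Bool
      inner-run blk       = false
      inner-run (run q s) = s <ᵇ r q
      per-run : ∀ q → count (suc (r q)) (λ s → s <ᵇ r q) ≡ r q
      per-run q rewrite count-below (r q) (r q) ≤-refl | <ᵇ-false {r q} (<-irrefl refl) = +-identityʳ (r q)
      yellow-succession : ∀ {q s} → Step q s → ((s <ᵇ r q) ∧ (τ (pos n d r q s) ≡ᵇ suc (pos n d r q s))) ≡ (s <ᵇ r q)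
      yellow-succession {q} {s} (along lt e) rewrite <ᵇ-true lt = ≡ᵇ-true (trans e (pos-suc n d r q s lt))
      yellow-succession {q}     (jump refl _) rewrite <ᵇ-false {r q} (<-irrefl refl) = refl
      by-label : ∀ i → i < N → (yellow n d r i ∧ (τ i ≡ᵇ suc i)) ≡ inner-run (at L i)
      by-label i i<N with view i i<N
      ... | in-block e rewrite yellow-blk i e | e = refl
      ... | in-run q s le refl = trans (cong (_∧ (τ (pos n d r q s) ≡ᵇ suc (pos n d r q s))) (yellow-run _ q s (at-pos n d r q s le)))
                                   (trans (yellow-succession (step q s le)) (cong inner-run (sym (at-pos n d r q s le))))

  cycle-count : cycles N τ ≡ cyclesPerm π + sumF d
  cycle-count = begin
    cycles N τ                                                   ≡⟨ count-by-labels _ is-min by-label ⟩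
    lcount is-min L                                              ≡⟨ lcount-layout n d r is-min ⟩
    count (d F.zero) (λ _ → true) + sumF (λ q → count (suc (r q)) (λ s → is-min (run q s)) + count (d (F.suc q)) (λ _ → true))
      ≡⟨ cong₂ _+_ (count-all (d F.zero) _ (λ _ → refl))
                   (sumF-cong _ _ (λ q → cong₂ _+_ (per-run q) (count-all (d (F.suc q)) _ (λ _ → refl)))) ⟩
    d F.zero + sumF (λ q → minima q + d (F.suc q))          ≡⟨ cong (d F.zero +_) (sumF-+ minima (λ q → d (F.suc q))) ⟩
    d F.zero + (sumF minima + sumF (λ q → d (F.suc q)))     ≡⟨ x∙yz≈y∙xz (d F.zero) (sumF minima) (sumF (λ q → d (F.suc q))) ⟩
    sumF minima + sumF d                                     ≡⟨ cong (_+ sumF d) (sym (count-sumF n _)) ⟩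
    cyclesPerm π + sumF d ∎
    where
      open ≡-Reasoning
      minima : Vector ℕ n
      minima q = b2n (least-π q)
      is-min : Label n → Bool
      is-min blk       = true
      is-min (run q s) = (s ≡ᵇ 0) ∧ least-π q
      per-run : ∀ q → count (suc (r q)) (λ s → is-min (run q s)) ≡ b2n (least-π q)
      per-run q = trans (count-cons (r q) _) (trans (cong (b2n (least-π q) +_) (count-none (r q) _ (λ _ → refl))) (+-identityʳ _))
      by-label : ∀ i → i < N → least-τ i ≡ is-min (at L i)
      by-label i i<N with view i i<N
      ... | in-block e rewrite e = least-τ-blk i e
      ... | in-run q zero    le refl rewrite at-pos n d r q 0 le = least-τ-start q
      ... | in-run q (suc s) le refl rewrite at-pos n d r q (suc s) le = least-τ-inner q s le

-- Finite sums and power series over a commutative ring.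
module SeriesAlgebra {c ℓ : Level} (R : CommutativeRing c ℓ) where
  open BooleanTests
  open import Data.Nat.Base using (_∸_; _≤_; _<_; z≤n; s≤s; _≤ᵇ_; _≡ᵇ_) renaming (_+_ to _+ℕ_)
  import Data.Nat.Properties as ℕP
  open import Data.List using (List; []; _∷_; _++_; map; concatMap; upTo)
  open import Data.List.Properties using (map-++; map-applyUpTo; map-∘; map-cong)
  open import Data.Vec.Functional using () renaming (_∷_ to _∷ᵥ_)
  open import Relation.Nullary using (yes; no)
  open CommutativeRing R renaming (Carrier to A)
  open import Relation.Binary.Reasoning.Setoid setoid
  open import Algebra.Properties.CommutativeSemigroup +-commutativeSemigroup using () renaming (interchange to +-interchange)
  open import Algebra.Properties.CommutativeSemigroup *-commutativeSemigroup using () renaming (interchange to *-interchange)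

  ∑ : List A → A
  ∑ = rsum R

  ∑-++ : ∀ xs ys → ∑ (xs ++ ys) ≈ ∑ xs + ∑ ys
  ∑-++ []       ys = sym (+-identityˡ _)
  ∑-++ (x ∷ xs) ys = trans (+-congˡ (∑-++ xs ys)) (sym (+-assoc x _ _))

  ∑-concatMap : ∀ {B : Set} (F : B → List A) xs → ∑ (concatMap F xs) ≈ ∑ (map (λ x → ∑ (F x)) xs)
  ∑-concatMap F []       = refl
  ∑-concatMap F (x ∷ xs) = trans (∑-++ (F x) (concatMap F xs)) (+-congˡ (∑-concatMap F xs))

  ∑-map-concatMap : ∀ {B C : Set} (φ : C → A) (F : B → List C) xs →
                    ∑ (map φ (concatMap F xs)) ≈ ∑ (map (λ x → ∑ (map φ (F x))) xs)
  ∑-map-concatMap φ F []       = refl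
  ∑-map-concatMap φ F (x ∷ xs) = trans (reflexive (≡.cong ∑ (map-++ φ (F x) (concatMap F xs))))
                                       (trans (∑-++ (map φ (F x)) _) (+-congˡ (∑-map-concatMap φ F xs)))

  ∑-cong : ∀ {B : Set} (f g : B → A) xs → (∀ x → f x ≈ g x) → ∑ (map f xs) ≈ ∑ (map g xs)
  ∑-cong f g []       h = refl
  ∑-cong f g (x ∷ xs) h = +-cong (h x) (∑-cong f g xs h)

  ∑-double-cong : ∀ {B C : Set} (f g : B → C → A) xs ys → (∀ x y → f x y ≈ g x y) →
                  ∑ (concatMap (λ x → map (f x) ys) xs) ≈ ∑ (concatMap (λ x → map (g x) ys) xs)
  ∑-double-cong f g xs ys h = trans (∑-concatMap _ xs)
    (trans (∑-cong _ _ xs (λ x → ∑-cong (f x) (g x) ys (h x))) (sym (∑-concatMap _ xs)))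

  ∑-zero : ∀ {B : Set} (f : B → A) xs → (∀ x → f x ≈ 0#) → ∑ (map f xs) ≈ 0#
  ∑-zero f []       h = refl
  ∑-zero f (x ∷ xs) h = trans (+-cong (h x) (∑-zero f xs h)) (+-identityˡ 0#)

  ∑-scale : ∀ {B : Set} (k : A) (f : B → A) xs → ∑ (map (λ x → k * f x) xs) ≈ k * ∑ (map f xs)
  ∑-scale k f []       = sym (zeroʳ k)
  ∑-scale k f (x ∷ xs) = trans (+-congˡ (∑-scale k f xs)) (sym (distribˡ k _ _))

  ∑-+ : ∀ {B : Set} (f g : B → A) xs → ∑ (map (λ x → f x + g x) xs) ≈ ∑ (map f xs) + ∑ (map g xs)
  ∑-+ f g []       = sym (+-identityˡ 0#)
  ∑-+ f g (x ∷ xs) = trans (+-congˡ (∑-+ f g xs)) (+-interchange (f x) (g x) _ _)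

  ∑< : ℕ → (ℕ → A) → A
  ∑< k F = ∑ (map F (upTo k))

  ∑<-suc : ∀ k F → ∑< (suc k) F ≡ F 0 + ∑< k (λ i → F (suc i))
  ∑<-suc k F = ≡.cong (λ z → F 0 + ∑ z)
    (≡.trans (map-applyUpTo suc F k) (≡.sym (map-applyUpTo (λ x → x) (λ i → F (suc i)) k)))

  ∑<-truncate : ∀ K B (G F : ℕ → A) → K ≤ B → (∀ v → v ≤ K → G v ≈ F v) → (∀ v → K < v → G v ≈ 0#) →
                ∑< (suc B) G ≈ ∑< (suc K) F
  ∑<-truncate zero B G F le agree vanish = begin
    ∑< (suc B) G                      ≡⟨ ∑<-suc B G ⟩
    G 0 + ∑< B (λ i → G (suc i))      ≈⟨ +-cong (agree 0 z≤n) (∑-zero _ (upTo B) (λ i → vanish (suc i) (s≤s z≤n))) ⟩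
    F 0 + 0# ∎
  ∑<-truncate (suc K) (suc B) G F (s≤s le) agree vanish = begin
    ∑< (suc (suc B)) G                ≡⟨ ∑<-suc (suc B) G ⟩
    G 0 + ∑< (suc B) (λ i → G (suc i))
      ≈⟨ +-cong (agree 0 z≤n) (∑<-truncate K B (λ i → G (suc i)) (λ i → F (suc i)) le
                                (λ v p → agree (suc v) (s≤s p)) (λ v p → vanish (suc v) (s≤s p))) ⟩
    F 0 + ∑< (suc K) (λ i → F (suc i)) ≡⟨ ≡.sym (∑<-suc (suc K) F) ⟩
    ∑< (suc (suc K)) F ∎

  pow-+ : ∀ x a b → pow R x (a +ℕ b) ≈ pow R x a * pow R x b
  pow-+ x zero    b = sym (*-identityˡ _)
  pow-+ x (suc a) b = trans (*-congˡ (pow-+ x a b)) (sym (*-assoc x _ _))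

  pow-* : ∀ x y k → pow R (x * y) k ≈ pow R x k * pow R y k
  pow-* x y zero    = sym (*-identityˡ 1#)
  pow-* x y (suc k) = trans (*-congˡ (pow-* x y k)) (*-interchange x y _ _)

  Ser : Set c
  Ser = Series R

  _⊛ₛ_ : Ser → Ser → Ser
  f ⊛ₛ g = _⊛_ R f g

  -- the series f without its constant term, divided by x
  shift : Ser → Ser
  shift f i = f (suc i)

  ⊛-zero : ∀ f g → (f ⊛ₛ g) 0 ≈ f 0 * g 0
  ⊛-zero f g = +-identityʳ _

  ⊛-suc : ∀ f g N → (f ⊛ₛ g) (suc N) ≡ f 0 * g (suc N) + (shift f ⊛ₛ g) N
  ⊛-suc f g N = ∑<-suc (suc N) (λ i → f i * g (suc N ∸ i))

  ⊛-congˡ : ∀ f f′ g → (∀ i → f i ≈ f′ i) → ∀ N → (f ⊛ₛ g) N ≈ (f′ ⊛ₛ g) N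
  ⊛-congˡ f f′ g h N = ∑-cong _ _ (upTo (suc N)) (λ i → *-congʳ (h i))

  ⊛-+ˡ : ∀ φ χ h N → ((λ i → φ i + χ i) ⊛ₛ h) N ≈ (φ ⊛ₛ h) N + (χ ⊛ₛ h) N
  ⊛-+ˡ φ χ h N = trans (∑-cong _ _ (upTo (suc N)) (λ i → distribʳ (h (N ∸ i)) (φ i) (χ i))) (∑-+ _ _ (upTo (suc N)))

  ⊛-*ˡ : ∀ k φ h N → ((λ i → k * φ i) ⊛ₛ h) N ≈ k * (φ ⊛ₛ h) N
  ⊛-*ˡ k φ h N = trans (∑-cong _ _ (upTo (suc N)) (λ i → *-assoc k (φ i) _)) (∑-scale k _ (upTo (suc N)))

  ⊛-zeroˡ : ∀ h N → ((λ _ → 0#) ⊛ₛ h) N ≈ 0#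
  ⊛-zeroˡ h N = ∑-zero _ (upTo (suc N)) (λ i → zeroˡ _)

  ⊛-assoc : ∀ f g h N → ((f ⊛ₛ g) ⊛ₛ h) N ≈ (f ⊛ₛ (g ⊛ₛ h)) N
  ⊛-assoc f g h zero = begin
    ((f ⊛ₛ g) ⊛ₛ h) 0       ≈⟨ trans (⊛-zero (f ⊛ₛ g) h) (*-congʳ (⊛-zero f g)) ⟩
    (f 0 * g 0) * h 0       ≈⟨ *-assoc (f 0) (g 0) (h 0) ⟩
    f 0 * (g 0 * h 0)       ≈⟨ sym (trans (⊛-zero f (g ⊛ₛ h)) (*-congˡ (⊛-zero g h))) ⟩
    (f ⊛ₛ (g ⊛ₛ h)) 0 ∎
  ⊛-assoc f g h (suc N) = begin
    ((f ⊛ₛ g) ⊛ₛ h) (suc N)                                     ≡⟨ ⊛-suc (f ⊛ₛ g) h N ⟩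
    (f ⊛ₛ g) 0 * h (suc N) + (shift (f ⊛ₛ g) ⊛ₛ h) N
      ≈⟨ +-cong (*-congʳ (⊛-zero f g))
                (⊛-congˡ (shift (f ⊛ₛ g)) (λ i → f 0 * shift g i + (shift f ⊛ₛ g) i) h (λ i → reflexive (⊛-suc f g i)) N) ⟩
    (f 0 * g 0) * h (suc N) + ((λ i → f 0 * shift g i + (shift f ⊛ₛ g) i) ⊛ₛ h) N
      ≈⟨ +-congˡ (⊛-+ˡ _ _ h N) ⟩
    (f 0 * g 0) * h (suc N) + (((λ i → f 0 * shift g i) ⊛ₛ h) N + ((shift f ⊛ₛ g) ⊛ₛ h) N)
      ≈⟨ +-congˡ (+-cong (⊛-*ˡ (f 0) (shift g) h N) (⊛-assoc (shift f) g h N)) ⟩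
    (f 0 * g 0) * h (suc N) + (f 0 * (shift g ⊛ₛ h) N + (shift f ⊛ₛ (g ⊛ₛ h)) N)
      ≈⟨ sym (+-assoc _ _ _) ⟩
    ((f 0 * g 0) * h (suc N) + f 0 * (shift g ⊛ₛ h) N) + (shift f ⊛ₛ (g ⊛ₛ h)) N
      ≈⟨ +-congʳ (trans (+-congʳ (*-assoc (f 0) (g 0) _)) (sym (distribˡ (f 0) _ _))) ⟩
    f 0 * (g 0 * h (suc N) + (shift g ⊛ₛ h) N) + (shift f ⊛ₛ (g ⊛ₛ h)) N
      ≈⟨ +-congʳ (*-congˡ (reflexive (≡.sym (⊛-suc g h N)))) ⟩
    f 0 * (g ⊛ₛ h) (suc N) + (shift f ⊛ₛ (g ⊛ₛ h)) N           ≡⟨ ≡.sym (⊛-suc f (g ⊛ₛ h) N) ⟩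
    (f ⊛ₛ (g ⊛ₛ h)) (suc N) ∎

  ⊛-oneˡ : ∀ g N → (oneS R ⊛ₛ g) N ≈ g N
  ⊛-oneˡ g zero    = trans (⊛-zero (oneS R) g) (*-identityˡ _)
  ⊛-oneˡ g (suc N) = trans (reflexive (⊛-suc (oneS R) g N)) (trans (+-cong (*-identityˡ _) (⊛-zeroˡ g N)) (+-identityʳ _))

  ⊛-oneʳ : ∀ g N → (g ⊛ₛ oneS R) N ≈ g N
  ⊛-oneʳ g zero    = trans (⊛-zero g (oneS R)) (*-identityʳ _)
  ⊛-oneʳ g (suc N) = trans (reflexive (⊛-suc g (oneS R) N)) (trans (+-cong (zeroʳ _) (⊛-oneʳ (shift g) N)) (+-identityˡ _))

  ⊛-const : ∀ k h N → (constS R k ⊛ₛ h) N ≈ k * h N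
  ⊛-const k h zero    = ⊛-zero (constS R k) h
  ⊛-const k h (suc N) = trans (reflexive (⊛-suc (constS R k) h N)) (trans (+-congˡ (⊛-zeroˡ h N)) (+-identityʳ _))

  ⊛-xpow : ∀ n h K → (xpowS R n ⊛ₛ h) (n +ℕ K) ≈ h K
  ⊛-xpow zero    h zero    = trans (⊛-zero (xpowS R 0) h) (*-identityˡ _)
  ⊛-xpow zero    h (suc K) = trans (reflexive (⊛-suc (xpowS R 0) h K)) (trans (+-cong (*-identityˡ _) (⊛-zeroˡ h K)) (+-identityʳ _))
  ⊛-xpow (suc n) h K       = trans (reflexive (⊛-suc (xpowS R (suc n)) h (n +ℕ K)))
                                   (trans (+-cong (zeroˡ _) (⊛-xpow n h K)) (+-identityˡ _))

  ⊛-xpow-low : ∀ n h M → M < n → (xpowS R n ⊛ₛ h) M ≈ 0#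
  ⊛-xpow-low (suc n) h zero    _        = trans (⊛-zero (xpowS R (suc n)) h) (zeroˡ _)
  ⊛-xpow-low (suc n) h (suc M) (s≤s lt) = trans (reflexive (⊛-suc (xpowS R (suc n)) h M))
                                                (trans (+-cong (zeroˡ _) (⊛-xpow-low n h M lt)) (+-identityˡ _))

  if-true : ∀ {b} {x y : A} → b ≡ true → (if b then x else y) ≡ x
  if-true ≡.refl = ≡.refl

  if-false : ∀ {b} {x y : A} → b ≡ false → (if b then x else y) ≡ y
  if-false ≡.refl = ≡.refl

  geomPow : A → ℕ → Ser
  geomPow a m = powS R (invOneMinus R a) m

  boxTerm : A → Ser → ℕ → ℕ → A
  boxTerm a g K V = if V ≤ᵇ K then pow R a V * g (K ∸ V) else 0#

  boxTerm-split : ∀ a g K v W → v ≤ K → boxTerm a g K (v +ℕ W) ≈ pow R a v * boxTerm a g (K ∸ v) W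
  boxTerm-split a g K v W v≤K with W ℕP.≤? K ∸ v
  ... | yes W≤ = begin
    boxTerm a g K (v +ℕ W)                    ≡⟨ if-true (≤ᵇ-true fits) ⟩
    pow R a (v +ℕ W) * g (K ∸ (v +ℕ W))       ≈⟨ *-cong (pow-+ a v W) (reflexive (≡.cong g (≡.sym (ℕP.∸-+-assoc K v W)))) ⟩
    (pow R a v * pow R a W) * g (K ∸ v ∸ W)   ≈⟨ *-assoc _ _ _ ⟩
    pow R a v * (pow R a W * g (K ∸ v ∸ W))   ≡⟨ ≡.cong (pow R a v *_) (≡.sym (if-true (≤ᵇ-true W≤))) ⟩
    pow R a v * boxTerm a g (K ∸ v) W ∎
    where fits : v +ℕ W ≤ K
          fits = ℕP.≤-trans (ℕP.+-monoʳ-≤ v W≤) (ℕP.≤-reflexive (ℕP.m+[n∸m]≡n v≤K))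
  ... | no W≰ = begin
    boxTerm a g K (v +ℕ W)                    ≡⟨ if-false (≤ᵇ-false too-big) ⟩
    0#                                        ≈⟨ sym (zeroʳ _) ⟩
    pow R a v * 0#                            ≡⟨ ≡.cong (pow R a v *_) (≡.sym (if-false (≤ᵇ-false W≰))) ⟩
    pow R a v * boxTerm a g (K ∸ v) W ∎
    where too-big : ¬ v +ℕ W ≤ K
          too-big fits = W≰ (ℕP.≤-trans (ℕP.≤-reflexive (≡.sym (ℕP.m+n∸m≡n v W))) (ℕP.∸-monoˡ-≤ v fits))

  -- Σ_{v ∈ [0,B]ᵐ} a^{Σv} g(K - Σv) is the coefficient of xᴷ in (1 - a x)⁻ᵐ g,
  -- as long as the box is large enough (K ≤ B): expand along the first coordinate
  box-sum : ∀ m B a g K → K ≤ B → ∑ (map (λ v → boxTerm a g K (sumF v)) (box m B)) ≈ (geomPow a m ⊛ₛ g) K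
  box-sum zero    B a g K K≤B = trans (+-identityʳ _) (trans (*-identityˡ _) (sym (⊛-oneˡ g K)))
  box-sum (suc m) B a g K K≤B = begin
    ∑ (map φ (box (suc m) B))                  ≈⟨ ∑-map-concatMap φ (λ v → map (v ∷ᵥ_) (box m B)) (upTo (suc B)) ⟩
    ∑ (map (λ v → ∑ (map φ (map (v ∷ᵥ_) (box m B)))) (upTo (suc B)))
      ≡⟨ ≡.cong ∑ (map-cong (λ v → ≡.cong ∑ (≡.sym (map-∘ (box m B)))) (upTo (suc B))) ⟩
    ∑< (suc B) G
      ≈⟨ ∑<-truncate K B G (λ v → pow R a v * (geomPow a m ⊛ₛ g) (K ∸ v)) K≤B low high ⟩
    (invOneMinus R a ⊛ₛ (geomPow a m ⊛ₛ g)) K ≈⟨ sym (⊛-assoc (invOneMinus R a) (geomPow a m) g K) ⟩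
    (geomPow a (suc m) ⊛ₛ g) K ∎
    where
      φ : Vector ℕ (suc m) → A
      φ v = boxTerm a g K (sumF v)
      G : ℕ → A
      G v = ∑ (map (λ w → φ (v ∷ᵥ w)) (box m B))
      low : ∀ v → v ≤ K → G v ≈ pow R a v * (geomPow a m ⊛ₛ g) (K ∸ v)
      low v v≤K = begin
        G v
          ≈⟨ ∑-cong _ _ (box m B) (λ w → boxTerm-split a g K v (sumF w) v≤K) ⟩
        ∑ (map (λ w → pow R a v * boxTerm a g (K ∸ v) (sumF w)) (box m B)) ≈⟨ ∑-scale (pow R a v) _ (box m B) ⟩
        pow R a v * ∑ (map (λ w → boxTerm a g (K ∸ v) (sumF w)) (box m B))
          ≈⟨ *-congˡ (box-sum m B a g (K ∸ v) (ℕP.≤-trans (ℕP.m∸n≤m K v) K≤B)) ⟩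
        pow R a v * (geomPow a m ⊛ₛ g) (K ∸ v) ∎
      high : ∀ v → K < v → G v ≈ 0#
      high v K<v = ∑-zero _ (box m B) (λ w → reflexive (if-false (≤ᵇ-false
                     (λ fits → ℕP.<-irrefl ≡.refl (ℕP.<-≤-trans K<v (ℕP.≤-trans (ℕP.m≤m+n v (sumF w)) fits))))))

  exact-term : ∀ a J V → (if V ≡ᵇ J then pow R a V else 0#) ≈ boxTerm a (oneS R) J V
  exact-term a J V with V ℕP.≟ J
  ... | yes ≡.refl = begin
    (if V ≡ᵇ V then pow R a V else 0#)  ≡⟨ if-true (≡ᵇ-true {V} ≡.refl) ⟩
    pow R a V                           ≈⟨ sym (*-identityʳ _) ⟩
    pow R a V * oneS R 0                ≡⟨ ≡.cong (λ z → pow R a V * oneS R z) (≡.sym (ℕP.n∸n≡0 V)) ⟩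
    pow R a V * oneS R (V ∸ V)          ≡⟨ ≡.sym (if-true (≤ᵇ-true (ℕP.≤-refl {V}))) ⟩
    boxTerm a (oneS R) V V ∎
  ... | no V≢J = trans (reflexive (if-false (≡ᵇ-false V≢J))) (sym vanishes)
    where
      vanishes : boxTerm a (oneS R) J V ≈ 0#
      vanishes with V ℕP.≤? J
      ... | no V≰J = reflexive (if-false (≤ᵇ-false V≰J))
      ... | yes V≤J with J ∸ V in eq
      ...   | zero  = ⊥-elim (V≢J (ℕP.≤-antisym V≤J (ℕP.m∸n≡0⇒m≤n eq)))
      ...   | suc _ = trans (reflexive (if-true (≤ᵇ-true V≤J))) (zeroʳ _)

  box-sum-exact : ∀ m B a J → J ≤ B → ∑ (map (λ v → if sumF v ≡ᵇ J then pow R a (sumF v) else 0#) (box m B)) ≈ geomPow a m J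
  box-sum-exact m B a J J≤B = begin
    ∑ (map (λ v → if sumF v ≡ᵇ J then pow R a (sumF v) else 0#) (box m B))
      ≈⟨ ∑-cong _ _ (box m B) (λ v → exact-term a J (sumF v)) ⟩
    ∑ (map (λ v → boxTerm a (oneS R) J (sumF v)) (box m B))                ≈⟨ box-sum m B a (oneS R) J J≤B ⟩
    (geomPow a m ⊛ₛ oneS R) J                                              ≈⟨ ⊛-oneʳ (geomPow a m) J ⟩
    geomPow a m J ∎

  -- The sum of the theorem once every weight is evaluated:
  --   Σ_{d ∈ [0,M]ⁿ⁺¹} Σ_{r ∈ [0,M]ⁿ} [n + Σd + Σr = M] C a^{Σd} u^{Σr}
  -- is the coefficient of xᴹ in xⁿ C (1 - a x)^{-(n+1)} (1 - u x)^{-n}.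
  module DoubleSum (C a u : A) (n : ℕ) where

    term : ℕ → ℕ → ℕ → A
    term M D S = if n +ℕ D +ℕ S ≡ᵇ M then C * (pow R a D * pow R u S) else 0#

    double-sum : ℕ → A
    double-sum M = ∑ (concatMap (λ d → map (λ r → term M (sumF d) (sumF r)) (box n M)) (box (suc n) M))

    product : Ser
    product = geomPow a (suc n) ⊛ₛ geomPow u n

    target : Ser
    target = xpowS R n ⊛ₛ (constS R C ⊛ₛ product)

    inner : ℕ → ℕ → A
    inner M D = ∑ (map (λ r → term M D (sumF r)) (box n M))

    double-sum-iterated : ∀ M → double-sum M ≈ ∑ (map (λ d → inner M (sumF d)) (box (suc n) M))
    double-sum-iterated M = ∑-concatMap _ (box (suc n) M)

    double-sum-low : ∀ M → M < n → double-sum M ≈ target M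
    double-sum-low M M<n = trans (double-sum-iterated M) (trans
      (∑-zero _ (box (suc n) M) (λ d → ∑-zero _ (box n M) (λ r → reflexive (if-false (≡ᵇ-false (too-big (sumF d) (sumF r)))))))
      (sym (⊛-xpow-low n (constS R C ⊛ₛ product) M M<n)))
      where
        too-big : ∀ D S → ¬ n +ℕ D +ℕ S ≡ M
        too-big D S e = ℕP.<-irrefl ≡.refl (ℕP.<-≤-trans M<n
          (ℕP.≤-trans (ℕP.m≤m+n n D) (ℕP.≤-trans (ℕP.m≤m+n (n +ℕ D) S) (ℕP.≤-reflexive e))))

    cancel-n : ∀ {D S K} → n +ℕ D +ℕ S ≡ n +ℕ K → D +ℕ S ≡ K
    cancel-n {D} {S} e = ℕP.+-cancelˡ-≡ n _ _ (≡.trans (≡.sym (ℕP.+-assoc n D S)) e)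

    exact-condition : ∀ K D S → D ≤ K → (n +ℕ D +ℕ S ≡ᵇ n +ℕ K) ≡ (S ≡ᵇ K ∸ D)
    exact-condition K D S D≤K = true-iff
      (λ e → ≡ᵇ-true (≡.trans (≡.sym (ℕP.m+n∸m≡n D S)) (≡.cong (_∸ D) (cancel-n (≡ᵇ-sound e)))))
      (λ e → ≡ᵇ-true (≡.trans (ℕP.+-assoc n D S)
                       (≡.cong (n +ℕ_) (≡.trans (≡.cong (D +ℕ_) (≡ᵇ-sound e)) (ℕP.m+[n∸m]≡n D≤K)))))

    inner-sum : ∀ K D → inner (n +ℕ K) D ≈ C * boxTerm a (geomPow u n) K D
    inner-sum K D with D ℕP.≤? K
    ... | no D≰K = trans (∑-zero _ (box n M) (λ r → reflexive (if-false (≡ᵇ-false (too-big (sumF r))))))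
                         (trans (sym (zeroʳ C)) (*-congˡ (reflexive (≡.sym (if-false (≤ᵇ-false D≰K))))))
      where
        M = n +ℕ K
        too-big : ∀ S → ¬ n +ℕ D +ℕ S ≡ M
        too-big S e = D≰K (ℕP.≤-trans (ℕP.m≤m+n D S) (ℕP.≤-reflexive (cancel-n e)))
    ... | yes D≤K = begin
      inner M D                                                ≈⟨ ∑-cong _ _ (box n M) (λ r → factor (sumF r)) ⟩
      ∑ (map (λ r → C * (pow R a D * ψ (sumF r))) (box n M))
        ≈⟨ trans (∑-scale C _ (box n M)) (*-congˡ (∑-scale (pow R a D) _ (box n M))) ⟩
      C * (pow R a D * ∑ (map (λ r → ψ (sumF r)) (box n M)))
        ≈⟨ *-congˡ (*-congˡ (box-sum-exact n M u (K ∸ D) (ℕP.≤-trans (ℕP.m∸n≤m K D) (ℕP.m≤n+m K n)))) ⟩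
      C * (pow R a D * geomPow u n (K ∸ D))                    ≡⟨ ≡.cong (C *_) (≡.sym (if-true (≤ᵇ-true D≤K))) ⟩
      C * boxTerm a (geomPow u n) K D ∎
      where
        M = n +ℕ K
        ψ : ℕ → A
        ψ S = if S ≡ᵇ K ∸ D then pow R u S else 0#
        factor : ∀ S → term M D S ≈ C * (pow R a D * ψ S)
        factor S rewrite exact-condition K D S D≤K with S ≡ᵇ K ∸ D
        ... | true  = refl
        ... | false = sym (trans (*-congˡ (zeroʳ _)) (zeroʳ C))

    double-sum-high : ∀ K → double-sum (n +ℕ K) ≈ target (n +ℕ K)
    double-sum-high K = begin
      double-sum M                                                  ≈⟨ double-sum-iterated M ⟩
      ∑ (map (λ d → inner M (sumF d)) (box (suc n) M))              ≈⟨ ∑-cong _ _ (box (suc n) M) (λ d → inner-sum K (sumF d)) ⟩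
      ∑ (map (λ d → C * boxTerm a (geomPow u n) K (sumF d)) (box (suc n) M)) ≈⟨ ∑-scale C _ (box (suc n) M) ⟩
      C * ∑ (map (λ d → boxTerm a (geomPow u n) K (sumF d)) (box (suc n) M))
        ≈⟨ *-congˡ (box-sum (suc n) M a (geomPow u n) K (ℕP.m≤n+m K n)) ⟩
      C * product K                                                 ≈⟨ sym (⊛-const C product K) ⟩
      (constS R C ⊛ₛ product) K                                     ≈⟨ sym (⊛-xpow n (constS R C ⊛ₛ product) K) ⟩
      target M ∎
      where M = n +ℕ K

    double-sum-series : ∀ M → double-sum M ≈ target M
    double-sum-series M with n ℕP.≤? M
    ... | no n≰M  = double-sum-low M (ℕP.≰⇒> n≰M)
    ... | yes n≤M = ≡.subst (λ z → double-sum z ≈ target z) (ℕP.m+[n∸m]≡n n≤M) (double-sum-high (M ∸ n))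

-- The W₁-weight of the colored permutation built from (π, d, r), without
-- x^N, is α^{f(π)} (αt)^{Σd} u^{Σr}.
module Weight {c ℓ : Level} (R : CommutativeRing c ℓ) (α t u : CommutativeRing.Carrier R)
              (n : ℕ) (π : Permutation′ n) where
  open import Data.Nat.Base using (_≡ᵇ_) renaming (_+_ to _+ℕ_)
  open CommutativeRing R
  open SeriesAlgebra R using (pow-+; pow-*; module DoubleSum)
  open import Relation.Binary.Reasoning.Setoid setoid

  C : Carrier
  C = pow R α (cyclesPerm π)

  weight-of-construction : ∀ d r →
    W1coeff R α t u (sizeN n d r) (tau n π d r) (red n d r) (yellow n d r) ≈ C * (pow R (α * t) (sumF d) * pow R u (sumF r))
  weight-of-construction d r = begin
    W1coeff R α t u (sizeN n d r) (tau n π d r) (red n d r) (yellow n d r)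
      ≡⟨ ≡.cong₂ (λ k l → monomial k l Y) cycle-count red-fixed-points ⟩
    monomial (cyclesPerm π +ℕ D) D Y                          ≡⟨ ≡.cong (monomial (cyclesPerm π +ℕ D) D) yellow-successions ⟩
    pow R α (cyclesPerm π +ℕ D) * (pow R t D * pow R u S)   ≈⟨ *-congʳ (pow-+ α (cyclesPerm π) D) ⟩
    (C * pow R α D) * (pow R t D * pow R u S)                ≈⟨ *-assoc C _ _ ⟩
    C * (pow R α D * (pow R t D * pow R u S))                ≈⟨ *-congˡ (sym (*-assoc _ _ _)) ⟩
    C * ((pow R α D * pow R t D) * pow R u S)                ≈⟨ *-congˡ (*-congʳ (sym (pow-* α t D))) ⟩
    C * (pow R (α * t) D * pow R u S) ∎
    where
      open Statistics n π d r using (cycle-count; red-fixed-points; yellow-successions)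
      open Tau n π d r using (N; τ)
      D = sumF d
      S = sumF r
      Y = count N (λ i → yellow n d r i ∧ (τ i ≡ᵇ suc i))
      monomial : ℕ → ℕ → ℕ → Carrier
      monomial k l m = pow R α k * (pow R t l * pow R u m)

  summand : ∀ M d r →
    (if sizeN n d r ≡ᵇ M then W1coeff R α t u (sizeN n d r) (tau n π d r) (red n d r) (yellow n d r) else 0#)
      ≈ DoubleSum.term C (α * t) u n M (sumF d) (sumF r)
  summand M d r with sizeN n d r ≡ᵇ M
  ... | true  = weight-of-construction d r
  ... | false = refl

lemma14 : {c ℓ : Level} (R : CommutativeRing c ℓ) (α t u : CommutativeRing.Carrier R)
          (n : ℕ) (π : Permutation′ n) (M : ℕ) →
          CommutativeRing._≈_ R (weightSum R α t u n π M) (rhsSeries R α t u n π M)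
lemma14 R α t u n π M = begin
  weightSum R α t u n π M    ≈⟨ ∑-double-cong _ _ (box (suc n) M) (box n M) (summand M) ⟩
  double-sum M               ≈⟨ double-sum-series M ⟩
  rhsSeries R α t u n π M ∎
  where
    open CommutativeRing R using (setoid; _*_)
    open import Relation.Binary.Reasoning.Setoid setoid
    open SeriesAlgebra R using (∑-double-cong)
    open Weight R α t u n π using (C; summand)
    open SeriesAlgebra.DoubleSum R C (α * t) u n using (double-sum; double-sum-series)
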